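{- Let $D$ be an $m$-colored semicomplete bipartite digraph, let $k\in\{2,3\}$, and suppose every subdigraph of $D$ isomorphic to $\overrightarrow{C}_4\upuparrows\overrightarrow{C}_4$ is at most $k$-colored. Let $x,y\in V(D)$. If there exists a $k$-colored directed path from $x$ to $y$ and there does not exist a $k'$-colored directed path from $y$ to $x$ with $k'\leq k$, then $d(x,y)\leq 2$.
   Context: A digraph is $m$-colored if each arc is assigned one of $m$ colors. A semicomplete bipartite digraph is obtained from a complete bipartite graph by replacing each edge $uv$ by the arc $(u,v)$, the arc $(v,u)$, or both. A directed path is $j$-colored if its arcs use exactly $j$ distinct colors; a subdigraph is at most $k$-colored if its arcs use at most $k$ colors. $\overrightarrow{C}_4\upuparrows\overrightarrow{C}_4$ is the digraph on five vertices $a,b,c,d,e$ with arcs $(a,b),(b,c),(c,d),(d,a),(c,e),(e,a)$, i.e. two directed $4$-cycles sharing two consecutive arcs. $d(x,y)$ denotes the minimum number of arcs of a directed path from $x$ to $y$. -}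

module Defs where

open import Data.Nat using (ℕ; _≤_)
open import Data.Fin using (Fin)
open import Data.Bool using (Bool; true)
open import Data.List using (List; []; _∷_; length)
open import Data.List.Membership.Propositional using (_∈_)
open import Data.List.Relation.Unary.Unique.Propositional using (Unique)
open import Data.Product using (Σ; _×_; ∃-syntax)
open import Data.Sum using (_⊎_)
open import Relation.Nullary using (¬_)
open import Relation.Binary.PropositionalEquality using (_≡_; _≢_)
open import Function.Bundles using (_⇔_)

-- An m-colored digraph on vertex set Fin n (no parallel arcs; each
-- ordered pair (u,v) is an arc or not). The colour of arc (u,v) is
-- colour u v (values on non-arcs are irrelevant).
record ColoredDigraph (m : ℕ) : Set where
  field
    n      : ℕ
    arc    : Fin n → Fin n → Bool
    colour : Fin n → Fin n → Fin m

  Arc : Fin n → Fin n → Set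
  Arc u v = arc u v ≡ true

module _ {m : ℕ} (D : ColoredDigraph m) where
  open ColoredDigraph D

  SemicompleteBipartite : Set
  SemicompleteBipartite =
    Σ (Fin n → Bool) λ side →
      (∀ u v → Arc u v → side u ≢ side v) ×
      (∀ u v → side u ≢ side v → Arc u v ⊎ Arc v u)

  data Walk : Fin n → Fin n → Set where
    []  : ∀ {x} → Walk x x
    _∷_ : ∀ {x y z} → Arc x y → Walk y z → Walk x z

  verts : ∀ {x y} → Walk x y → List (Fin n)
  verts {x} []      = x ∷ []
  verts {x} (_ ∷ w) = x ∷ verts w

  arcColours : ∀ {x y} → Walk x y → List (Fin m)
  arcColours []                 = []
  arcColours (_∷_ {x} {y} _ w) = colour x y ∷ arcColours w

  numArcs : ∀ {x y} → Walk x y → ℕ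
  numArcs []      = 0
  numArcs (_ ∷ w) = ℕ.suc (numArcs w)
    where import Data.Nat as ℕ

  IsPath : ∀ {x y} → Walk x y → Set
  IsPath w = Unique (verts w)

  DistAtMost : Fin n → Fin n → ℕ → Set
  DistAtMost x y j = ∃[ w ] (IsPath {x} {y} w × numArcs w ≤ j)

ExactlyColoured : ∀ {m} → List (Fin m) → ℕ → Set
ExactlyColoured {m} cs j =
  ∃[ ds ] (Unique ds × length ds ≡ j × (∀ (c : Fin m) → (c ∈ ds) ⇔ (c ∈ cs)))

AtMostColoured : ∀ {m} → List (Fin m) → ℕ → Set
AtMostColoured cs k = ∃[ j ] (j ≤ k × ExactlyColoured cs j)

module _ {m : ℕ} (D : ColoredDigraph m) where
  open ColoredDigraph D

  C4C4AtMost : ℕ → Set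
  C4C4AtMost k =
    ∀ a b c d e → Unique (a ∷ b ∷ c ∷ d ∷ e ∷ []) →
    Arc a b → Arc b c → Arc c d → Arc d a → Arc c e → Arc e a →
    AtMostColoured (colour a b ∷ colour b c ∷ colour c d ∷ colour d a ∷
                    colour c e ∷ colour e a ∷ []) k

module Submission where

-- Then x ≠ y, there is no arc y → x, and no
-- two-arc return path y → z → x (a path with ≤ 2 arcs has ≤ 2 ≤ k colours).
-- If x and y lie on different sides of the bipartition, semicompleteness
-- and the absence of y → x give the arc x → y.  Otherwise walk along p,
-- keeping a vertex v on the side opposite to y with x → v and a subpath
-- v ⇝ y avoiding x.  If v → y we are done (x → v → y).  If not, then
-- y → v, and the subpath continues v → u → z with z on v's side.  The
-- arc must be x → z: an arc z → x would either give a two-arc return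
-- path y → z → x, or (if z → y) make v,u,z,x,y a C4⇈C4 whose colours,
-- at most k by hypothesis, include those of the return path
-- y → v → u → z → x.  So we continue with z, strictly closer to y.

open import Defs
open import Data.Nat using (ℕ; suc; _≤_; z≤n; s≤s)
open import Data.Nat.Properties using (≤-trans)
open import Data.Fin using (Fin; _≟_)
open import Data.Bool using (Bool; true)
open import Data.Bool.Properties using (¬-not)
import Data.Bool as Bool
open import Data.Empty using (⊥; ⊥-elim)
open import Data.List using (List; []; _∷_; _++_; length; deduplicate; filter)
open import Data.List.Properties using (length-deduplicate; length-filter)
open import Data.List.Membership.Propositional.Properties
  using (∈-deduplicate⁻; ∈-deduplicate⁺; ∈-filter⁺; ∈-filter⁻)
open import Data.List.Relation.Binary.Subset.Propositional using (_⊆_)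
open import Data.List.Relation.Unary.All using (All; []; _∷_)
open import Data.List.Relation.Unary.All.Properties using (++⁻)
open import Data.List.Relation.Unary.AllPairs using ([]; _∷_)
open import Data.List.Relation.Unary.Any using (here; there)
open import Data.List.Relation.Unary.Unique.Propositional using (Unique)
open import Data.List.Relation.Unary.Unique.Propositional.Properties using (filter⁺)
open import Data.List.Relation.Unary.Unique.DecPropositional.Properties using (deduplicate-!)
open import Data.Product using (_×_; _,_; proj₂; ∃-syntax)
open import Data.Sum using (_⊎_; inj₁; inj₂)
open import Function.Bundles using (mk⇔; Equivalence)
open import Relation.Nullary using (¬_; Dec; yes; no)
open import Relation.Binary.PropositionalEquality
  using (_≡_; _≢_; refl; sym; trans; cong; subst; ≢-sym)

atMostColoured-length : ∀ {m} (cs : List (Fin m)) → AtMostColoured cs (length cs)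
atMostColoured-length cs =
  length (deduplicate _≟_ cs) , length-deduplicate _≟_ cs ,
  deduplicate _≟_ cs , deduplicate-! _≟_ cs , refl ,
  λ c → mk⇔ (∈-deduplicate⁻ _≟_ cs) (∈-deduplicate⁺ _≟_)

atMostColoured-mono : ∀ {m j k} {cs : List (Fin m)} → j ≤ k →
  AtMostColoured cs j → AtMostColoured cs k
atMostColoured-mono j≤k (i , i≤j , exact) = i , ≤-trans i≤j j≤k , exact

-- If every colour of cs' occurs in cs, then cs' uses at most as many
-- colours as cs: keep those distinct colours of cs that occur in cs'.
atMostColoured-⊆ : ∀ {m k} {cs cs' : List (Fin m)} →
  AtMostColoured cs k → cs' ⊆ cs → AtMostColoured cs' k
atMostColoured-⊆ {m} {cs' = cs'} (j , j≤k , ds , distinct , refl , ds≈cs) cs'⊆cs =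
  length kept , ≤-trans (length-filter (_∈? cs') ds) j≤k ,
  kept , filter⁺ (_∈? cs') distinct , refl ,
  λ c → mk⇔ (λ c∈kept → proj₂ (∈-filter⁻ (_∈? cs') {xs = ds} c∈kept))
            (λ c∈cs' → ∈-filter⁺ (_∈? cs') (Equivalence.from (ds≈cs c) (cs'⊆cs c∈cs')) c∈cs')
  where
    open import Data.List.Membership.DecPropositional (_≟_ {m}) using (_∈?_)
    kept : List (Fin m)
    kept = filter (_∈? cs') ds

unique-rotate : ∀ {A : Set} (xs : List A) {e : A} →
  Unique (xs ++ e ∷ []) → Unique (e ∷ xs)
unique-rotate [] u = u
unique-rotate (a ∷ xs) (a∉rest ∷ u) with ++⁻ xs a∉rest | unique-rotate xs u
... | a∉xs , (a≢e ∷ []) | e∉xs ∷ uxs = (≢-sym a≢e ∷ e∉xs) ∷ a∉xs ∷ uxs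

module Walks {m : ℕ} (D : ColoredDigraph m) where
  open ColoredDigraph D

  arc? : ∀ u v → Dec (Arc u v)
  arc? u v = arc u v Bool.≟ true

  All-verts-head : ∀ {P : Fin n → Set} {u v} (w : Walk D u v) → All P (verts D w) → P u
  All-verts-head []      (pu ∷ _) = pu
  All-verts-head (_ ∷ _) (pu ∷ _) = pu

  length-arcColours : ∀ {u v} (w : Walk D u v) → length (arcColours D w) ≡ numArcs D w
  length-arcColours []      = refl
  length-arcColours (_ ∷ w) = cong suc (length-arcColours w)

  shortWalk-atMostColoured : ∀ {u v k} (w : Walk D u v) → numArcs D w ≤ k →
    AtMostColoured (arcColours D w) k
  shortWalk-atMostColoured w short =
    atMostColoured-mono (subst (_≤ _) (sym (length-arcColours w)) short)
                        (atMostColoured-length (arcColours D w))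

  ColouredPath : Fin n → Fin n → ℕ → Set
  ColouredPath u v k = ∃[ q ] (IsPath D {u} {v} q × AtMostColoured (arcColours D q) k)

module Bipartite {m : ℕ} (D : ColoredDigraph m)
  (side : Fin (ColoredDigraph.n D) → Bool)
  (crossing : ∀ u v → ColoredDigraph.Arc D u v → side u ≢ side v)
  (semicomplete : ∀ u v → side u ≢ side v → ColoredDigraph.Arc D u v ⊎ ColoredDigraph.Arc D v u)
  where
  open ColoredDigraph D

  arc-sides : ∀ {u v} → Arc u v → side u ≢ side v
  arc-sides = crossing _ _

  arc-≢ : ∀ {u v} → Arc u v → u ≢ v
  arc-≢ uv refl = arc-sides uv refl

  reverse-arc : ∀ {u v} → side u ≢ side v → ¬ Arc v u → Arc u v
  reverse-arc {u} {v} su≢sv ¬vu with semicomplete u v su≢sv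
  ... | inj₁ uv = uv
  ... | inj₂ vu = ⊥-elim (¬vu vu)

  side-twoArcs : ∀ {v u z} → Arc v u → Arc u z → side v ≡ side z
  side-twoArcs vu uz = trans (¬-not (arc-sides vu)) (sym (¬-not (≢-sym (arc-sides uz))))

  arc-path : ∀ {u v} (uv : Arc u v) → IsPath D (uv ∷ [])
  arc-path uv = (arc-≢ uv ∷ []) ∷ [] ∷ []

  twoArc-path : ∀ {u v w} (uv : Arc u v) (vw : Arc v w) → u ≢ w → IsPath D (uv ∷ vw ∷ [])
  twoArc-path uv vw u≢w = (arc-≢ uv ∷ u≢w ∷ []) ∷ (arc-≢ vw ∷ []) ∷ [] ∷ []

module ShortDistance {m : ℕ} (D : ColoredDigraph m) (k : ℕ) (2≤k : 2 ≤ k)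
  (side : Fin (ColoredDigraph.n D) → Bool)
  (crossing : ∀ u v → ColoredDigraph.Arc D u v → side u ≢ side v)
  (semicomplete : ∀ u v → side u ≢ side v → ColoredDigraph.Arc D u v ⊎ ColoredDigraph.Arc D v u)
  (c4c4 : C4C4AtMost D k)
  (x y : Fin (ColoredDigraph.n D))
  (noReturn : ¬ Walks.ColouredPath D y x k)
  where
  open ColoredDigraph D
  open Walks D
  open Bipartite D side crossing semicomplete

  x≢y : x ≢ y
  x≢y refl = noReturn ([] , [] ∷ [] , shortWalk-atMostColoured {u = x} [] z≤n)

  -- A return path with at most two arcs uses at most 2 ≤ k colours.
  noShortReturn : (q : Walk D y x) → IsPath D q → numArcs D q ≤ 2 → ⊥
  noShortReturn q path short =
    noReturn (q , path , shortWalk-atMostColoured q (≤-trans short 2≤k))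

  noReturnArc : ¬ Arc y x
  noReturnArc yx = noShortReturn (yx ∷ []) (arc-path yx) (s≤s z≤n)

  noReturnTwoArcs : ∀ {z} → Arc y z → ¬ Arc z x
  noReturnTwoArcs yz zx =
    noShortReturn (yz ∷ zx ∷ []) (twoArc-path yz zx (≢-sym x≢y)) (s≤s (s≤s z≤n))

  -- A C4⇈C4 on v,u,z,x,y (cycles v u z x and v u z y) contains the return
  -- path y → v → u → z → x, whose colours are among its own.
  noReturnThroughC4C4 : ∀ {v u z} → Unique (v ∷ u ∷ z ∷ x ∷ y ∷ []) →
    Arc v u → Arc u z → Arc z x → Arc x v → Arc z y → Arc y v → ⊥
  noReturnThroughC4C4 {v} {u} {z} distinct vu uz zx xv zy yv =
    noReturn (yv ∷ vu ∷ uz ∷ zx ∷ [] ,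
              unique-rotate (v ∷ u ∷ z ∷ x ∷ []) distinct ,
              atMostColoured-⊆ (c4c4 v u z x y distinct vu uz zx xv zy yv) returnColours)
    where
      returnColours : (colour y v ∷ colour v u ∷ colour u z ∷ colour z x ∷ []) ⊆
                      (colour v u ∷ colour u z ∷ colour z x ∷ colour x v ∷ colour z y ∷ colour y v ∷ [])
      returnColours (here refl)                         = there (there (there (there (there (here refl)))))
      returnColours (there (here refl))                 = here refl
      returnColours (there (there (here refl)))         = there (here refl)
      returnColours (there (there (there (here refl)))) = there (there (here refl))

  -- An arc z → x at the end of x → v → u → z (v opposite to y, v ↛ y,
  -- on a path) is impossible: if z ↛ y then y → z → x returns in two
  -- arcs, and if z → y then v,u,z,x,y span a C4⇈C4.
  noArcBack : ∀ {v u z} → Arc x v → side v ≢ side y → ¬ Arc v y →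
    Arc v u → Arc u z → v ≢ z → x ≢ u → ¬ Arc z x
  noArcBack {v} {u} {z} xv sv≢sy ¬vy vu uz v≢z x≢u zx with arc? z y
  ... | no ¬zy = noReturnTwoArcs (reverse-arc sy≢sz ¬zy) zx
    where
      sy≢sz : side y ≢ side z
      sy≢sz sy≡sz = sv≢sy (trans (side-twoArcs vu uz) (sym sy≡sz))
  ... | yes zy = noReturnThroughC4C4 distinct vu uz zx xv zy yv
    where
      yv : Arc y v
      yv = reverse-arc (≢-sym sv≢sy) ¬vy
      u≢y : u ≢ y
      u≢y u≡y = ¬vy (subst (Arc v) u≡y vu)
      distinct : Unique (v ∷ u ∷ z ∷ x ∷ y ∷ [])
      distinct = (arc-≢ vu ∷ v≢z ∷ ≢-sym (arc-≢ xv) ∷ ≢-sym (arc-≢ yv) ∷ [])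
               ∷ (arc-≢ uz ∷ ≢-sym x≢u ∷ u≢y ∷ [])
               ∷ (arc-≢ zx ∷ arc-≢ zy ∷ [])
               ∷ (x≢y ∷ []) ∷ [] ∷ []

  -- Key step: in that situation x → z, since z is opposite to x and the
  -- arc z → x is excluded.
  jumpAhead : ∀ {v u z} → Arc x v → side v ≢ side y → ¬ Arc v y →
    Arc v u → Arc u z → v ≢ z → x ≢ u → Arc x z
  jumpAhead {z = z} xv sv≢sy ¬vy vu uz v≢z x≢u =
    reverse-arc sx≢sz (noArcBack xv sv≢sy ¬vy vu uz v≢z x≢u)
    where
      sx≢sz : side x ≢ side z
      sx≢sz sx≡sz = arc-sides xv (trans sx≡sz (sym (side-twoArcs vu uz)))

  -- Walk along a path x → v ⇝ y whose second vertex v is opposite to y: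
  -- stop at the first such v with v → y, otherwise jump two steps ahead.
  alongPath : ∀ {v} (xv : Arc x v) (w : Walk D v y) → IsPath D (xv ∷ w) →
    side v ≢ side y → DistAtMost D x y 2
  alongPath xv w path sv≢sy with arc? _ y
  ... | yes vy = (xv ∷ vy ∷ []) , twoArc-path xv vy x≢y , s≤s (s≤s z≤n)
  alongPath xv [] _ sv≢sy | no _ = ⊥-elim (sv≢sy refl)
  alongPath xv (vy ∷ []) _ _ | no ¬vy = ⊥-elim (¬vy vy)
  alongPath xv (vu ∷ uz ∷ w) ((_ ∷ x≢u ∷ x∉w) ∷ (_ ∷ v∉w) ∷ (_ ∷ uniq-w)) sv≢sy | no ¬vy =
    alongPath (jumpAhead xv sv≢sy ¬vy vu uz (All-verts-head w v∉w) x≢u) w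
              (x∉w ∷ uniq-w) (subst (_≢ side y) (side-twoArcs vu uz) sv≢sy)

  distanceAtMostTwo : (p : Walk D x y) → IsPath D p → DistAtMost D x y 2
  distanceAtMostTwo p path with side x Bool.≟ side y
  ... | no sx≢sy = (xy ∷ []) , arc-path xy , s≤s z≤n
    where
      xy : Arc x y
      xy = reverse-arc sx≢sy noReturnArc
  distanceAtMostTwo []       _    | yes _     = ⊥-elim (x≢y refl)
  distanceAtMostTwo (xv ∷ w) path | yes sx≡sy =
    alongPath xv w path (λ sv≡sy → arc-sides xv (trans sx≡sy (sym sv≡sy)))

-- Theorem 9.
-- The two admissible values of k are at least 2.
twoOrThree⇒2≤ : ∀ {k} → k ≡ 2 ⊎ k ≡ 3 → 2 ≤ k
twoOrThree⇒2≤ (inj₁ refl) = s≤s (s≤s z≤n)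
twoOrThree⇒2≤ (inj₂ refl) = s≤s (s≤s z≤n)

mainTheorem9 : ∀ {m : ℕ} (D : ColoredDigraph m) (k : ℕ) →
    SemicompleteBipartite D →
    (k ≡ 2 ⊎ k ≡ 3) →
    C4C4AtMost D k →
    (x y : Fin (ColoredDigraph.n D)) →
    (∃[ p ] (IsPath D {x} {y} p × ExactlyColoured (arcColours D p) k)) →
    ¬ (∃[ k' ] (k' ≤ k × (∃[ q ] (IsPath D {y} {x} q × ExactlyColoured (arcColours D q) k')))) →
    DistAtMost D x y 2
mainTheorem9 D k (side , crossing , semicomplete) k∈23 c4c4 x y (p , path , _) noReturn =
  ShortDistance.distanceAtMostTwo D k (twoOrThree⇒2≤ k∈23) side crossing semicomplete c4c4 x y noColouredReturn p path
  where
    noColouredReturn : ¬ Walks.ColouredPath D y x k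
    noColouredReturn (q , pathq , j , j≤k , exact) = noReturn (j , j≤k , q , pathq , exact)
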